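{- For every graph $G$, $ChVS(G)\le ChED(G)$. Moreover, $ChVS$ is not lower-bounded by $ChED$ even on graphs $G$ with $\alpha(G)\le 2$: there is no function $f$ such that $ChED(G)\le f(ChVS(G))$ for all graphs $G$ with $\alpha(G)\le 2$.
   Context: All graphs are finite, simple and undirected. A (vertex) split of a vertex $v$ of a graph $G$ chooses sets $A,B\subseteq N_G(v)$ with $A\cup B=N_G(v)$ and replaces $v$ by two new vertices $v_1,v_2$, where $v_1$ is adjacent exactly to $A$ and $v_2$ exactly to $B$ (all other adjacencies unchanged). A chordal graph is a graph with no induced cycle of length at least $4$. $ChVS(G)$ is the minimum length of a sequence of splits turning $G$ into a chordal graph; $ChED(G)$ is the minimum number of edge deletions turning $G$ into a chordal graph. $\alpha(G)$ is the maximum size of an independent set of $G$. -}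

module Defs where

open import Data.Nat using (ℕ; zero; suc; _+_; _≤_; _%_)
open import Data.Fin using (Fin; zero; suc; toℕ; _≟_)
open import Data.Bool using (Bool; true; false; if_then_else_; _∨_; _∧_)
open import Data.Product using (Σ; _×_; _,_; ∃)
open import Data.Sum using (_⊎_)
open import Relation.Binary.PropositionalEquality using (_≡_)
open import Relation.Nullary using (¬_; does)
open import Function.Definitions using (Injective)

record Graph (n : ℕ) : Set where
  field
    adj   : Fin n → Fin n → Bool
    sym   : ∀ x y → adj x y ≡ adj y x
    irref : ∀ x → adj x x ≡ false
open Graph public

Adj : ∀ {n} → Graph n → Fin n → Fin n → Set
Adj G x y = adj G x y ≡ true

CycAdj : ∀ m → Fin (4 + m) → Fin (4 + m) → Set
CycAdj m i j = (toℕ j ≡ suc (toℕ i) % (4 + m)) ⊎ (toℕ i ≡ suc (toℕ j) % (4 + m))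

InducedCycle : ∀ {n} (G : Graph n) (m : ℕ) → (Fin (4 + m) → Fin n) → Set
InducedCycle G m c =
  Injective _≡_ _≡_ c ×
  (∀ i j → (Adj G (c i) (c j) → CycAdj m i j) × (CycAdj m i j → Adj G (c i) (c j)))

Chordal : ∀ {n} → Graph n → Set
Chordal {n} G = ∀ (m : ℕ) (c : Fin (4 + m) → Fin n) → ¬ InducedCycle G m c

-- Adjacency after splitting vertex v into v₁, v₂ using A, B ⊆ N(v).
-- In the new vertex set Fin (suc n): suc x is the old vertex x (suc v plays
-- the role of v₁, adjacent exactly to A), and zero is the new vertex v₂
-- (adjacent exactly to B).
splitAdj : ∀ {n} → Graph n → Fin n → (Fin n → Bool) → (Fin n → Bool) →
           Fin (suc n) → Fin (suc n) → Bool
splitAdj G v A B zero    zero    = false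
splitAdj G v A B zero    (suc y) = B y
splitAdj G v A B (suc x) zero    = B x
splitAdj G v A B (suc x) (suc y) =
  if does (x ≟ v) then A y else (if does (y ≟ v) then A x else adj G x y)

Split : ∀ {n} → Graph n → Graph (suc n) → Set
Split {n} G H =
  Σ (Fin n) λ v → Σ (Fin n → Bool) λ A → Σ (Fin n → Bool) λ B →
    (∀ x → A x ≡ true → Adj G v x) ×
    (∀ x → B x ≡ true → Adj G v x) ×
    (∀ x → Adj G v x → A x ∨ B x ≡ true) ×
    (∀ x y → adj H x y ≡ splitAdj G v A B x y)

DeleteEdge : ∀ {n} → Graph n → Graph n → Set
DeleteEdge {n} G H =
  Σ (Fin n) λ u → Σ (Fin n) λ w →
    Adj G u w ×
    (∀ x y → adj H x y ≡
       (if (does (x ≟ u) ∧ does (y ≟ w)) ∨ (does (x ≟ w) ∧ does (y ≟ u))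
        then false else adj G x y))

data SplitsToChordal : ∀ {n} → Graph n → ℕ → Set where
  done : ∀ {n} {G : Graph n} → Chordal G → SplitsToChordal G 0
  step : ∀ {n k} {G : Graph n} {H : Graph (suc n)} →
         Split G H → SplitsToChordal H k → SplitsToChordal G (suc k)

data DeletionsToChordal : ∀ {n} → Graph n → ℕ → Set where
  done : ∀ {n} {G : Graph n} → Chordal G → DeletionsToChordal G 0
  step : ∀ {n k} {G H : Graph n} →
         DeleteEdge G H → DeletionsToChordal H k → DeletionsToChordal G (suc k)

IsChVS : ∀ {n} → Graph n → ℕ → Set
IsChVS G k = SplitsToChordal G k × (∀ j → SplitsToChordal G j → k ≤ j)

IsChED : ∀ {n} → Graph n → ℕ → Set
IsChED G k = DeletionsToChordal G k × (∀ j → DeletionsToChordal G j → k ≤ j)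

αAtMost : ∀ {n} → Graph n → ℕ → Set
αAtMost {n} G a =
  ∀ (k : ℕ) (S : Fin k → Fin n) → Injective _≡_ _≡_ S →
    (∀ i j → adj G (S i) (S j) ≡ false) → k ≤ a

{-# OPTIONS --safe #-}
module Submission where

-- Deleting an edge uw can be imitated by a split of u into a copy with neighbourhood N(u) − w
-- and a new vertex adjacent only to w. The result is the graph after the deletion plus a
-- pendant vertex; pendant vertices lie on no induced cycle, and any later split can be copied
-- into a graph carrying extra pendant vertices, so every deletion sequence yields a split
-- sequence of the same length and ChVS ≤ ChED.
--
-- For the separation take cliques {P i} and {Q i} (i < t), a vertex X joined to all of them
-- and a vertex S joined to all of them. The cliques {X, P i} and {S, Q i} cover the graph, so
-- α ≤ 2. The 4-cycles S P_i X Q_i are induced and pairwise edge-disjoint, and one deletion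
-- destroys at most one of them, so ChED ≥ t (deleting the edges S P_i shows ChED = t). But
-- splitting S into a copy adjacent to the P i and a copy adjacent to the Q i leaves X together
-- with two disjoint cliques, which is chordal, so ChVS = 1.

open import Defs hiding (sym)
open import Data.Bool using (Bool; true; false; not; if_then_else_; _∨_)
open import Data.Bool.Properties using (T-≡; ¬-not; ∨-zeroʳ; ∨-identityʳ)
open import Data.Fin using (Fin; zero; suc; toℕ; fromℕ<; lift; punchIn; splitAt; join; _↑ˡ_; _↑ʳ_)
open import Data.Fin.Patterns using (0F; 1F; 2F; 3F)
open import Data.Fin.Properties
  using (_≟_; any?; all?; ¬∀⟶∃¬; injective⇒≤; toℕ-injective; toℕ-fromℕ<; toℕ<n; suc-injective;
         lift-injective; punchIn-injective; punchInᵢ≢i; splitAt-↑ˡ; splitAt-↑ʳ; join-splitAt)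
open import Data.Maybe using (Maybe; just; nothing)
open import Data.Maybe.Properties using (just-injective)
open import Data.Nat
  using (ℕ; zero; suc; _+_; _∸_; _≤_; _<_; _%_; _<ᵇ_; z≤n; s≤s; z<s; s<s; _<?_; NonZero)
import Data.Nat as ℕ
open import Data.Nat.DivMod
  using (_mod_; %-distribˡ-+; m%n%n≡m%n; m<n⇒m%n≡m; m%n<n; [m+n]%n≡m%n; m≤n⇒[n∸m]%m≡n%m)
open import Data.Nat.Properties
  using (m<n+m; ≮⇒≥; ∸-monoˡ-<; m+n∸m≡n; +-monoˡ-<; <⇒≢; <-trans; +-suc; m≤n⇒m≤1+n; <⇒<ᵇ; <⇒≤;
         ≤-refl; 1+n≰n)
open import Data.Product using (Σ; ∃-syntax; _×_; _,_; proj₁; proj₂)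
open import Data.Sum using (_⊎_; inj₁; inj₂; [_,_]′)
open import Function using (_∘_; id; _⇔_; mk⇔; Equivalence)
open import Function.Definitions using (Injective)
open import Relation.Nullary using (¬_; yes; no; does; Dec; contradiction; _×-dec_; _⊎-dec_)
open import Relation.Nullary.Decidable using (dec-true; dec-false; False; toWitnessFalse)
open import Relation.Binary.PropositionalEquality

Adj-irrefl : ∀ {n} (G : Graph n) {x} → ¬ Adj G x x
Adj-irrefl G {x} xx = contradiction (trans (sym (irref G x)) xx) λ ()

Adj⇒≢ : ∀ {n} (G : Graph n) {x y} → Adj G x y → x ≢ y
Adj⇒≢ G xy refl = Adj-irrefl G xy

Adj-sym : ∀ {n} (G : Graph n) {x y} → Adj G x y → Adj G y x
Adj-sym G {x} {y} xy = trans (Graph.sym G y x) xy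

[d+r]%n≢r : ∀ {d r n} .{{_ : NonZero n}} → 0 < d → d < n → r < n → (d + r) % n ≢ r
[d+r]%n≢r {d} {r} {n} 0<d d<n r<n eq with d + r <? n
... | yes d+r<n = <⇒≢ (m<n+m r 0<d) (sym (trans (sym (m<n⇒m%n≡m d+r<n)) eq))
... | no d+r≮n  = <⇒≢ d+r∸n<r (trans (sym wrapped) eq)
  where
  n≤d+r : n ≤ d + r
  n≤d+r = ≮⇒≥ d+r≮n
  d+r∸n<r : d + r ∸ n < r
  d+r∸n<r = subst (d + r ∸ n <_) (m+n∸m≡n n r) (∸-monoˡ-< (+-monoˡ-< r d<n) n≤d+r)
  wrapped : (d + r) % n ≡ d + r ∸ n
  wrapped = trans (sym (m≤n⇒[n∸m]%m≡n%m n≤d+r)) (m<n⇒m%n≡m (<-trans d+r∸n<r r<n))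

module _ {m : ℕ} where

  pos : ℕ → Fin (4 + m)
  pos a = a mod (4 + m)

  toℕ-pos : ∀ a → toℕ (pos a) ≡ a % (4 + m)
  toℕ-pos a = toℕ-fromℕ< (m%n<n a (4 + m))

  pos-toℕ : ∀ i → pos (toℕ i) ≡ i
  pos-toℕ i = toℕ-injective (trans (toℕ-pos (toℕ i)) (m<n⇒m%n≡m (toℕ<n i)))

  pos-+-period : ∀ a → pos (a + (4 + m)) ≡ pos a
  pos-+-period a = toℕ-injective (begin
    toℕ (pos (a + (4 + m)))  ≡⟨ toℕ-pos (a + (4 + m)) ⟩
    (a + (4 + m)) % (4 + m)  ≡⟨ [m+n]%n≡m%n a (4 + m) ⟩
    a % (4 + m)              ≡⟨ toℕ-pos a ⟨
    toℕ (pos a)              ∎)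
    where open ≡-Reasoning

  pos-+-≢ : ∀ d a → 0 < d → d < 4 + m → pos (d + a) ≢ pos a
  pos-+-≢ d a 0<d d<L eq = [d+r]%n≢r 0<d d<L (m%n<n a (4 + m)) (begin
    (d + a % (4 + m)) % (4 + m)                     ≡⟨ %-distribˡ-+ d (a % (4 + m)) (4 + m) ⟩
    (d % (4 + m) + a % (4 + m) % (4 + m)) % (4 + m) ≡⟨ cong (λ r → (d % (4 + m) + r) % (4 + m))
                                                              (m%n%n≡m%n a (4 + m)) ⟩
    (d % (4 + m) + a % (4 + m)) % (4 + m)           ≡⟨ %-distribˡ-+ d a (4 + m) ⟨
    (d + a) % (4 + m)                               ≡⟨ toℕ-pos (d + a) ⟨
    toℕ (pos (d + a))                               ≡⟨ cong toℕ eq ⟩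
    toℕ (pos a)                                     ≡⟨ toℕ-pos a ⟩
    a % (4 + m)                                     ∎)
    where open ≡-Reasoning

  toℕ-pos-suc : ∀ a → toℕ (pos (suc a)) ≡ suc (toℕ (pos a)) % (4 + m)
  toℕ-pos-suc a = begin
    toℕ (pos (suc a))            ≡⟨ toℕ-pos (suc a) ⟩
    (1 + a) % (4 + m)            ≡⟨ %-distribˡ-+ 1 a (4 + m) ⟩
    suc (a % (4 + m)) % (4 + m)  ≡⟨ cong (λ r → suc r % (4 + m)) (toℕ-pos a) ⟨
    suc (toℕ (pos a)) % (4 + m)  ∎
    where open ≡-Reasoning

  pos-suc-adjacent : ∀ a → CycAdj m (pos a) (pos (suc a))
  pos-suc-adjacent a = inj₁ (toℕ-pos-suc a)

  pos-2-nonadjacent : ∀ a → ¬ CycAdj m (pos a) (pos (2 + a))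
  pos-2-nonadjacent a (inj₁ eq) =
    pos-+-≢ 1 (suc a) z<s (s<s z<s) (toℕ-injective (trans eq (sym (toℕ-pos-suc a))))
  pos-2-nonadjacent a (inj₂ eq) =
    pos-+-≢ 3 a z<s (s<s (s<s (s<s z<s))) (toℕ-injective (sym (trans eq (sym (toℕ-pos-suc (2 + a))))))

cycAdj? : ∀ m (i j : Fin (4 + m)) → Dec (CycAdj m i j)
cycAdj? m i j = (toℕ j ℕ.≟ suc (toℕ i) % (4 + m)) ⊎-dec (toℕ i ℕ.≟ suc (toℕ j) % (4 + m))

-- For concrete positions the implicit argument is found by evaluation.
¬cycAdj : ∀ {m i j} {_ : False (cycAdj? m i j)} → ¬ CycAdj m i j
¬cycAdj {_} {_} {_} {¬ij} = toWitnessFalse ¬ij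

cycAdj-sym : ∀ {m i j} → CycAdj m i j → CycAdj m j i
cycAdj-sym (inj₁ ij) = inj₂ ij
cycAdj-sym (inj₂ ji) = inj₁ ji

-- Induced paths on induced cycles, and two chordality criteria

record InducedPath₃ {n} (G : Graph n) (p q r : Fin n) : Set where
  field
    ends-distinct    : p ≢ r
    left-adjacent    : Adj G p q
    right-adjacent   : Adj G q r
    ends-nonadjacent : ¬ Adj G p r

module _ {n m} {G : Graph n} {c : Fin (4 + m) → Fin n} (cycle : InducedCycle G m c) where

  private
    c-injective : Injective _≡_ _≡_ c
    c-injective = proj₁ cycle

    edge : ∀ i j → CycAdj m i j → Adj G (c i) (c j)
    edge i j = proj₂ (proj₂ cycle i j)

    chordless : ∀ i j → Adj G (c i) (c j) → CycAdj m i j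
    chordless i j = proj₁ (proj₂ cycle i j)

  inducedCycle-path₃ : ∀ a → InducedPath₃ G (c (pos a)) (c (pos (1 + a))) (c (pos (2 + a)))
  inducedCycle-path₃ a = record
    { ends-distinct    = λ eq → pos-+-≢ 2 a z<s (s<s (s<s z<s)) (sym (c-injective eq))
    ; left-adjacent    = edge _ _ (pos-suc-adjacent a)
    ; right-adjacent   = edge _ _ (pos-suc-adjacent (1 + a))
    ; ends-nonadjacent = pos-2-nonadjacent a ∘ chordless _ _
    }

  inducedCycle-path₃-through : ∀ i → ∃[ p ] ∃[ r ] InducedPath₃ G p (c i) r
  inducedCycle-path₃-through i =
    _ , _ , subst (λ j → InducedPath₃ G (c (pos a)) (c j) (c (pos (2 + a)))) centre
                  (inducedCycle-path₃ a)
    where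
    a : ℕ
    a = toℕ i + (3 + m)
    centre : pos (1 + a) ≡ i
    centre = trans (cong pos (sym (+-suc (toℕ i) (3 + m)))) (trans (pos-+-period (toℕ i)) (pos-toℕ i))

  -- If x = c j, the three positions after j avoid it, as the cycle has length at least 4.
  inducedCycle-path₃-avoiding : ∀ x →
    ∃[ p ] ∃[ q ] ∃[ r ] InducedPath₃ G p q r × p ≢ x × q ≢ x × r ≢ x
  inducedCycle-path₃-avoiding x with any? (λ j → c j ≟ x)
  ... | no x∉c = _ , _ , _ , inducedCycle-path₃ 0 , off , off , off
    where
    off : ∀ {i} → c i ≢ x
    off {i} eq = x∉c (i , eq)
  ... | yes (j , refl) = _ , _ , _ , inducedCycle-path₃ (1 + toℕ j) ,
    away 1 z<s (s<s z<s) , away 2 z<s (s<s (s<s z<s)) , away 3 z<s (s<s (s<s (s<s z<s)))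
    where
    away : ∀ d → 0 < d → d < 4 + m → c (pos (d + toℕ j)) ≢ c j
    away d 0<d d<L eq = pos-+-≢ d (toℕ j) 0<d d<L (trans (c-injective eq) (sym (pos-toℕ j)))

clusterMinusVertex⇒chordal : ∀ {n} {C : Set} (G : Graph n) (x : Fin n) (κ : Fin n → C) →
  (∀ p q → p ≢ x → q ≢ x → p ≢ q → Adj G p q ⇔ κ p ≡ κ q) → Chordal G
clusterMinusVertex⇒chordal G x κ cluster m c cycle
  with p , q , r , path , p≢x , q≢x , r≢x
         ← inducedCycle-path₃-avoiding {m = m} {G = G} {c = c} cycle x =
  ends-nonadjacent (from (cluster p r p≢x r≢x ends-distinct)
    (trans (to (cluster p q p≢x q≢x (Adj⇒≢ G left-adjacent)) left-adjacent)
           (to (cluster q r q≢x r≢x (Adj⇒≢ G right-adjacent)) right-adjacent)))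
  where
  open InducedPath₃ path
  open Equivalence

cliqueCover⇒αAtMost : ∀ {n k} (G : Graph n) (κ : Fin n → Fin k) →
  (∀ x y → x ≢ y → κ x ≡ κ y → Adj G x y) → αAtMost G k
cliqueCover⇒αAtMost G κ clique j I I-injective independent = injective⇒≤ κ∘I-injective
  where
  κ∘I-injective : Injective _≡_ _≡_ (κ ∘ I)
  κ∘I-injective {a} {b} same-clique with I a ≟ I b
  ... | yes Ia≡Ib = I-injective Ia≡Ib
  ... | no Ia≢Ib  = contradiction (trans (sym (independent a b)) (clique _ _ Ia≢Ib same-clique)) λ ()

inducedC₄ : ∀ {n} {G : Graph n} (c : Fin 4 → Fin n) →
  Adj G (c 0F) (c 1F) → Adj G (c 1F) (c 2F) → Adj G (c 2F) (c 3F) → Adj G (c 3F) (c 0F) →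
  ¬ Adj G (c 0F) (c 2F) → ¬ Adj G (c 1F) (c 3F) → c 0F ≢ c 2F → c 1F ≢ c 3F →
  InducedCycle G 0 c
inducedC₄ {G = G} c e₀₁ e₁₂ e₂₃ e₃₀ ¬e₀₂ ¬e₁₃ c₀≢c₂ c₁≢c₃ = injective , induced
  where
  injective : ∀ {a b} → c a ≡ c b → a ≡ b
  injective {0F} {0F} _  = refl
  injective {1F} {1F} _  = refl
  injective {2F} {2F} _  = refl
  injective {3F} {3F} _  = refl
  injective {0F} {1F} eq = contradiction eq (Adj⇒≢ G e₀₁)
  injective {0F} {2F} eq = contradiction eq c₀≢c₂
  injective {0F} {3F} eq = contradiction (sym eq) (Adj⇒≢ G e₃₀)
  injective {1F} {0F} eq = contradiction (sym eq) (Adj⇒≢ G e₀₁)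
  injective {1F} {2F} eq = contradiction eq (Adj⇒≢ G e₁₂)
  injective {1F} {3F} eq = contradiction eq c₁≢c₃
  injective {2F} {0F} eq = contradiction (sym eq) c₀≢c₂
  injective {2F} {1F} eq = contradiction (sym eq) (Adj⇒≢ G e₁₂)
  injective {2F} {3F} eq = contradiction eq (Adj⇒≢ G e₂₃)
  injective {3F} {0F} eq = contradiction eq (Adj⇒≢ G e₃₀)
  injective {3F} {1F} eq = contradiction (sym eq) c₁≢c₃
  injective {3F} {2F} eq = contradiction (sym eq) (Adj⇒≢ G e₂₃)

  Induced : Fin 4 → Fin 4 → Set
  Induced a b = (Adj G (c a) (c b) → CycAdj 0 a b) × (CycAdj 0 a b → Adj G (c a) (c b))

  edge : ∀ {a b} → CycAdj 0 a b → Adj G (c a) (c b) → Induced a b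
  edge ab e = (λ _ → ab) , (λ _ → e)

  non-edge : ∀ {a b} → ¬ CycAdj 0 a b → ¬ Adj G (c a) (c b) → Induced a b
  non-edge ¬ab ¬e = (λ e → contradiction e ¬e) , (λ ab → contradiction ab ¬ab)

  induced : ∀ a b → Induced a b
  induced 0F 0F = non-edge (¬cycAdj {0}) (Adj-irrefl G)
  induced 0F 1F = edge (inj₁ refl) e₀₁
  induced 0F 2F = non-edge (¬cycAdj {0}) ¬e₀₂
  induced 0F 3F = edge (inj₂ refl) (Adj-sym G e₃₀)
  induced 1F 0F = edge (inj₂ refl) (Adj-sym G e₀₁)
  induced 1F 1F = non-edge (¬cycAdj {0}) (Adj-irrefl G)
  induced 1F 2F = edge (inj₁ refl) e₁₂
  induced 1F 3F = non-edge (¬cycAdj {0}) ¬e₁₃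
  induced 2F 0F = non-edge (¬cycAdj {0}) (¬e₀₂ ∘ Adj-sym G)
  induced 2F 1F = edge (inj₂ refl) (Adj-sym G e₁₂)
  induced 2F 2F = non-edge (¬cycAdj {0}) (Adj-irrefl G)
  induced 2F 3F = edge (inj₁ refl) e₂₃
  induced 3F 0F = edge (inj₁ refl) e₃₀
  induced 3F 1F = non-edge (¬cycAdj {0}) (¬e₁₃ ∘ Adj-sym G)
  induced 3F 2F = edge (inj₂ refl) (Adj-sym G e₂₃)
  induced 3F 3F = non-edge (¬cycAdj {0}) (Adj-irrefl G)

-- Splits and pendant extensions

splitAdj-sym : ∀ {n} (G : Graph n) v A B x y → splitAdj G v A B x y ≡ splitAdj G v A B y x
splitAdj-sym G v A B zero    zero    = refl
splitAdj-sym G v A B zero    (suc y) = refl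
splitAdj-sym G v A B (suc x) zero    = refl
splitAdj-sym G v A B (suc x) (suc y) with x ≟ v | y ≟ v
... | yes refl | yes refl = refl
... | yes _    | no _     = refl
... | no _     | yes _    = refl
... | no _     | no _     = Graph.sym G x y

splitAdj-irrefl : ∀ {n} (G : Graph n) v A B → (∀ x → A x ≡ true → Adj G v x) →
  ∀ x → splitAdj G v A B x x ≡ false
splitAdj-irrefl G v A B A⊆N zero = refl
splitAdj-irrefl G v A B A⊆N (suc x) with x ≟ v
... | no _ = irref G x
... | yes refl with A x in Ax
...   | false = refl
...   | true  = contradiction (A⊆N x Ax) (Adj-irrefl G)

splitGraph : ∀ {n} (G : Graph n) v A B → (∀ x → A x ≡ true → Adj G v x) → Graph (suc n)
splitGraph G v A B A⊆N = record
  { adj = splitAdj G v A B ; sym = splitAdj-sym G v A B ; irref = splitAdj-irrefl G v A B A⊆N }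

splitGraph-split : ∀ {n} {G : Graph n} {v A B} (A⊆N : ∀ x → A x ≡ true → Adj G v x) →
  (∀ x → B x ≡ true → Adj G v x) → (∀ x → Adj G v x → A x ∨ B x ≡ true) →
  Split G (splitGraph G v A B A⊆N)
splitGraph-split {v = v} {A} {B} A⊆N B⊆N covers = v , A , B , A⊆N , B⊆N , covers , λ _ _ → refl

AtMostOneNeighbour : ∀ {n} → Graph n → Fin n → Set
AtMostOneNeighbour G y = ∀ z z′ → Adj G y z → Adj G y z′ → z ≡ z′

splitGraph-atMostOneNeighbour : ∀ {n} (G : Graph n) {v A B y} (A⊆N : ∀ x → A x ≡ true → Adj G v x) →
  y ≢ v → A y ≡ adj G v y → B y ≡ false →
  AtMostOneNeighbour G y → AtMostOneNeighbour (splitGraph G v A B A⊆N) (suc y)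
splitGraph-atMostOneNeighbour G {v} {A} {B} {y} A⊆N y≢v Ay By unique z z′ yz yz′ =
  same-neighbour (neighbour z yz) (neighbour z′ yz′)
  where
  neighbour : ∀ z → splitAdj G v A B (suc y) z ≡ true → ∃[ z₀ ] z ≡ suc z₀ × Adj G y z₀
  neighbour zero    yz = contradiction (trans (sym By) yz) λ ()
  neighbour (suc z) yz with y ≟ v
  ... | yes y≡v = contradiction y≡v y≢v
  ... | no _ with z ≟ v
  ...   | yes refl = z , refl , trans (Graph.sym G y z) (trans (sym Ay) yz)
  ...   | no _     = z , refl , yz

  same-neighbour : ∀ {z z′} → ∃[ z₀ ] z ≡ suc z₀ × Adj G y z₀ → ∃[ z₀ ] z′ ≡ suc z₀ × Adj G y z₀ → z ≡ z′
  same-neighbour (z₀ , refl , yz₀) (z₀′ , refl , yz₀′) = cong suc (unique z₀ z₀′ yz₀ yz₀′)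

record Embedding {n n′} (H : Graph n) (H′ : Graph n′) : Set where
  field
    embed           : Fin n → Fin n′
    embed-injective : Injective _≡_ _≡_ embed
    embed-adj       : ∀ a b → adj H′ (embed a) (embed b) ≡ adj H a b

  embed-Adj : ∀ {a b} → Adj H a b → Adj H′ (embed a) (embed b)
  embed-Adj {a} {b} = trans (embed-adj a b)

  embed-≟ : ∀ a b → does (embed a ≟ embed b) ≡ does (a ≟ b)
  embed-≟ a b with a ≟ b | embed a ≟ embed b
  ... | yes _    | yes _     = refl
  ... | no _     | no _      = refl
  ... | yes refl | no ea≢eb  = contradiction refl ea≢eb
  ... | no a≢b   | yes ea≡eb = contradiction (embed-injective ea≡eb) a≢b

  inducedCycle-pullback : ∀ {m c′} (c : Fin (4 + m) → Fin n) → (∀ i → embed (c i) ≡ c′ i) →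
    InducedCycle H′ m c′ → InducedCycle H m c
  inducedCycle-pullback {m} {c′} c over (c′-injective , c′-induced) = c-injective , c-induced
    where
    adj-over : ∀ i j → adj H (c i) (c j) ≡ adj H′ (c′ i) (c′ j)
    adj-over i j = trans (sym (embed-adj (c i) (c j))) (cong₂ (adj H′) (over i) (over j))

    c-injective : Injective _≡_ _≡_ c
    c-injective {i} {j} eq = c′-injective (trans (sym (over i)) (trans (cong embed eq) (over j)))

    c-induced : ∀ i j → (Adj H (c i) (c j) → CycAdj m i j) × (CycAdj m i j → Adj H (c i) (c j))
    c-induced i j = (proj₁ (c′-induced i j) ∘ trans (sym (adj-over i j)))
                  , (trans (adj-over i j) ∘ proj₂ (c′-induced i j))

module _ {n n′} {H : Graph n} {H′ : Graph n′} (emb : Embedding H H′) where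
  open Embedding emb

  splitAdj-embed : ∀ {v A B A′ B′} → (∀ a → A′ (embed a) ≡ A a) → (∀ a → B′ (embed a) ≡ B a) →
    ∀ x y → splitAdj H′ (embed v) A′ B′ (lift 1 embed x) (lift 1 embed y) ≡ splitAdj H v A B x y
  splitAdj-embed A′≗A B′≗B zero    zero    = refl
  splitAdj-embed A′≗A B′≗B zero    (suc b) = B′≗B b
  splitAdj-embed A′≗A B′≗B (suc a) zero    = B′≗B a
  splitAdj-embed {v} A′≗A B′≗B (suc a) (suc b) rewrite embed-≟ a v | embed-≟ b v with a ≟ v
  ... | yes _ = A′≗A b
  ... | no _ with b ≟ v
  ...   | yes _ = A′≗A a
  ...   | no _  = embed-adj a b

record PendantExtension {n n′} (H : Graph n) (H′ : Graph n′) : Set where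
  field
    embedding : Embedding H H′
  open Embedding embedding public
  field
    pendant : ∀ y → (∀ a → embed a ≢ y) → AtMostOneNeighbour H′ y

  image? : ∀ y → Dec (∃[ a ] embed a ≡ y)
  image? y = any? λ a → embed a ≟ y

module _ {n n′} {H : Graph n} {H′ : Graph n′} (ext : PendantExtension H H′) where
  open PendantExtension ext

  -- An induced cycle leaving the image would pass through a vertex with at most one neighbour.
  pendantExtension-chordal : Chordal H → Chordal H′
  pendantExtension-chordal chordal m c cycle with all? (image? ∘ c)
  ... | yes c⊆image =
    chordal m (proj₁ ∘ c⊆image) (inducedCycle-pullback _ (proj₂ ∘ c⊆image) cycle)
  ... | no c⊈image
    with i , i∉image ← ¬∀⟶∃¬ _ _ (image? ∘ c) c⊈image
    with p , r , path ← inducedCycle-path₃-through {m = m} {G = H′} {c = c} cycle i =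
    ends-distinct (pendant (c i) (λ a eq → i∉image (a , eq)) p r
                           (Adj-sym H′ left-adjacent) right-adjacent)
    where open InducedPath₃ path

  private
    extend : (Fin n → Bool) → (Fin n′ → Bool) → Fin n′ → Bool
    extend A outside y with image? y
    ... | yes (a , _) = A a
    ... | no _        = outside y

    extend-embed : ∀ A outside a → extend A outside (embed a) ≡ A a
    extend-embed A outside a with image? (embed a)
    ... | yes (b , eb) = cong A (embed-injective eb)
    ... | no a∉image   = contradiction (a , refl) a∉image

    extend-outside : ∀ A outside y → (∀ a → embed a ≢ y) → extend A outside y ≡ outside y
    extend-outside A outside y y∉image with image? y
    ... | yes (a , eq) = contradiction eq (y∉image a)
    ... | no _         = refl

    extend-⊆ : ∀ {v} C outside → (∀ a → C a ≡ true → Adj H v a) →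
      (∀ y → outside y ≡ true → Adj H′ (embed v) y) →
      ∀ y → extend C outside y ≡ true → Adj H′ (embed v) y
    extend-⊆ C outside C⊆N outside⊆N y with image? y
    ... | yes (a , refl) = embed-Adj ∘ C⊆N a
    ... | no _           = outside⊆N y

  -- The pendant vertices adjacent to embed v go to the copy of v on the A side, so they stay pendant.
  pendantExtension-split : ∀ {H₂ : Graph (suc n)} → Split H H₂ →
    ∃[ H₂′ ] Split H′ H₂′ × PendantExtension H₂ H₂′
  pendantExtension-split {H₂} (v , A , B , A⊆N , B⊆N , covers , H₂-adj) =
    H₂′ , splitGraph-split A′⊆N B′⊆N covers′ , record { embedding = embedding₂ ; pendant = pendant₂ }
    where
    A′ B′ : Fin n′ → Bool
    A′ = extend A (adj H′ (embed v))
    B′ = extend B (λ _ → false)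

    A′⊆N : ∀ y → A′ y ≡ true → Adj H′ (embed v) y
    A′⊆N = extend-⊆ A _ A⊆N (λ _ vy → vy)

    B′⊆N : ∀ y → B′ y ≡ true → Adj H′ (embed v) y
    B′⊆N = extend-⊆ B _ B⊆N (λ _ ())

    covers′ : ∀ y → Adj H′ (embed v) y → A′ y ∨ B′ y ≡ true
    covers′ y with image? y
    ... | yes (a , refl) = covers a ∘ trans (sym (embed-adj v a))
    ... | no _           = trans (∨-identityʳ _)

    H₂′ : Graph (suc n′)
    H₂′ = splitGraph H′ (embed v) A′ B′ A′⊆N

    embedding₂ : Embedding H₂ H₂′
    embedding₂ = record
      { embed           = lift 1 embed
      ; embed-injective = lift-injective embed embed-injective 1
      ; embed-adj       = λ x y →
          trans (splitAdj-embed embedding (extend-embed A _) (extend-embed B _) x y) (sym (H₂-adj x y))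
      }

    pendant₂ : ∀ y → (∀ a → lift 1 embed a ≢ y) → AtMostOneNeighbour H₂′ y
    pendant₂ zero    y∉image = contradiction refl (y∉image zero)
    pendant₂ (suc y) y∉image = splitGraph-atMostOneNeighbour H′ A′⊆N (y∉image₀ v ∘ sym)
      (extend-outside A _ y y∉image₀) (extend-outside B _ y y∉image₀) (pendant y y∉image₀)
      where
      y∉image₀ : ∀ a → embed a ≢ y
      y∉image₀ a = y∉image (suc a) ∘ cong suc

pendantExtension-splitsToChordal : ∀ {n n′ k} {H : Graph n} {H′ : Graph n′} →
  PendantExtension H H′ → SplitsToChordal H k → SplitsToChordal H′ k
pendantExtension-splitsToChordal ext (done chordal) = done (pendantExtension-chordal ext chordal)
pendantExtension-splitsToChordal ext (step split rest)
  with H₂′ , split′ , ext₂ ← pendantExtension-split ext split =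
  step split′ (pendantExtension-splitsToChordal ext₂ rest)

SamePair : ∀ {A : Set} → A → A → A → A → Set
SamePair x y u w = (x ≡ u × y ≡ w) ⊎ (x ≡ w × y ≡ u)

samePair? : ∀ {n} (x y u w : Fin n) → Dec (SamePair x y u w)
samePair? x y u w = (x ≟ u ×-dec y ≟ w) ⊎-dec (x ≟ w ×-dec y ≟ u)

-- The last component of DeleteEdge: does (samePair? x y u w) is definitionally its Boolean condition.
record DeletesEdge {n} (G H : Graph n) (u w : Fin n) : Set where
  constructor deletesEdge
  field
    deleted-adj : ∀ x y → adj H x y ≡ (if does (samePair? x y u w) then false else adj G x y)

module _ {n} {G H : Graph n} {u w : Fin n} (deletes : DeletesEdge G H u w) where
  open DeletesEdge deletes

  deletesEdge-pair : ∀ {x y} → SamePair x y u w → adj H x y ≡ false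
  deletesEdge-pair {x} {y} same =
    trans (deleted-adj x y) (cong (if_then false else adj G x y) (dec-true (samePair? x y u w) same))

  deletesEdge-other : ∀ {x y} → ¬ SamePair x y u w → adj H x y ≡ adj G x y
  deletesEdge-other {x} {y} other =
    trans (deleted-adj x y) (cong (if_then false else adj G x y) (dec-false (samePair? x y u w) other))

  deletesEdge-⊆ : ∀ {x y} → Adj H x y → Adj G x y
  deletesEdge-⊆ {x} {y} xy with samePair? x y u w
  ... | yes same = contradiction (trans (sym (deletesEdge-pair same)) xy) λ ()
  ... | no other = trans (sym (deletesEdge-other other)) xy

≡-if-dec : ∀ {P : Set} {r a b : Bool} (p? : Dec P) → (P → r ≡ a) → (¬ P → r ≡ b) →
  r ≡ (if does p? then a else b)
≡-if-dec (yes p) if-p _    = if-p p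
≡-if-dec (no ¬p) _    if-¬p = if-¬p ¬p

deletesEdge-intro : ∀ {n} {G H : Graph n} {u w} → ¬ Adj H u w →
  (∀ x y → ¬ SamePair x y u w → adj H x y ≡ adj G x y) → DeletesEdge G H u w
deletesEdge-intro {H = H} {u} {w} ¬uw unchanged =
  deletesEdge λ x y → ≡-if-dec (samePair? x y u w) deleted (unchanged x y)
  where
  deleted : ∀ {x y} → SamePair x y u w → adj H x y ≡ false
  deleted (inj₁ (refl , refl)) = ¬-not ¬uw
  deleted (inj₂ (refl , refl)) = trans (Graph.sym H w u) (¬-not ¬uw)

module _ {n} {G H : Graph n} {u w} (uw : Adj G u w) (deletes : DeletesEdge G H u w) where

  private
    B : Fin n → Bool
    B y = does (y ≟ w)

    A⊆N : ∀ y → adj H u y ≡ true → Adj G u y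
    A⊆N y = deletesEdge-⊆ deletes

    B⊆N : ∀ y → B y ≡ true → Adj G u y
    B⊆N y with y ≟ w
    ... | yes refl = λ _ → uw
    ... | no _     = λ ()

    covers : ∀ y → Adj G u y → adj H u y ∨ B y ≡ true
    covers y uy with y ≟ w
    ... | yes _  = ∨-zeroʳ _
    ... | no y≢w = trans (∨-identityʳ _) (trans (deletesEdge-other deletes other) uy)
      where
      other : ¬ SamePair u y u w
      other (inj₁ (_ , y≡w)) = y≢w y≡w
      other (inj₂ (u≡w , _)) = Adj⇒≢ G uw u≡w

  DeletionSplit : Graph (suc n)
  DeletionSplit = splitGraph G u (adj H u) B A⊆N

  deletionSplit-adj : ∀ a b → adj DeletionSplit (suc a) (suc b) ≡ adj H a b
  deletionSplit-adj a b with a ≟ u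
  ... | yes refl = refl
  ... | no a≢u with b ≟ u
  ...   | yes refl = Graph.sym H u a
  ...   | no b≢u   = sym (deletesEdge-other deletes other)
    where
    other : ¬ SamePair a b u w
    other (inj₁ (a≡u , _)) = a≢u a≡u
    other (inj₂ (_ , b≡u)) = b≢u b≡u

  deletionSplit-pendant : ∀ y → (∀ a → suc a ≢ y) → AtMostOneNeighbour DeletionSplit y
  deletionSplit-pendant (suc y) y∉image = contradiction refl (y∉image y)
  deletionSplit-pendant zero _ (suc z) (suc z′) yz yz′ with z ≟ w | z′ ≟ w
  ... | yes refl | yes refl = refl

  deletion-as-split : ∃[ G′ ] Split G G′ × PendantExtension H G′
  deletion-as-split = DeletionSplit , splitGraph-split A⊆N B⊆N covers , record
    { embedding = record { embed = suc ; embed-injective = suc-injective ; embed-adj = deletionSplit-adj }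
    ; pendant   = deletionSplit-pendant
    }

deletionsToChordal⇒splitsToChordal : ∀ {n k} {G : Graph n} →
  DeletionsToChordal G k → SplitsToChordal G k
deletionsToChordal⇒splitsToChordal (done chordal) = done chordal
deletionsToChordal⇒splitsToChordal (step (u , w , uw , deletes) rest)
  with G′ , split , ext ← deletion-as-split uw (deletesEdge deletes) =
  step split (pendantExtension-splitsToChordal ext (deletionsToChordal⇒splitsToChordal rest))

chvs≤ched : ∀ {n} (G : Graph n) (a b : ℕ) → IsChVS G a → IsChED G b → a ≤ b
chvs≤ched G a b (_ , minimal) (deletions , _) = minimal b (deletionsToChordal⇒splitsToChordal deletions)

-- Edge-disjoint induced cycles force deletions

HasEdge : ∀ {n} m → (Fin (4 + m) → Fin n) → Fin n → Fin n → Set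
HasEdge m c u w = ∃[ a ] ∃[ b ] CycAdj m a b × c a ≡ u × c b ≡ w

hasEdge? : ∀ {n} m (c : Fin (4 + m) → Fin n) u w → Dec (HasEdge m c u w)
hasEdge? m c u w = any? λ a → any? λ b → cycAdj? m a b ×-dec c a ≟ u ×-dec c b ≟ w

EdgesPresent : ∀ {n} → Graph n → ∀ m → (Fin (4 + m) → Fin n) → Set
EdgesPresent H m c = ∀ a b → CycAdj m a b → Adj H (c a) (c b)

inducedCycle-edgesPresent : ∀ {n m} {G : Graph n} {c} → InducedCycle G m c → EdgesPresent G m c
inducedCycle-edgesPresent (_ , induced) a b = proj₂ (induced a b)

inducedCycle-spanning : ∀ {n m} {G H : Graph n} {c} → (∀ x y → Adj H x y → Adj G x y) →
  InducedCycle G m c → EdgesPresent H m c → InducedCycle H m c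
inducedCycle-spanning H⊆G (c-injective , induced) present =
  c-injective , λ a b → (proj₁ (induced a b) ∘ H⊆G _ _) , present a b

edgesPresent-deletesEdge : ∀ {n m} {H H′ : Graph n} {u w c} → DeletesEdge H H′ u w →
  EdgesPresent H m c → ¬ HasEdge m c u w → EdgesPresent H′ m c
edgesPresent-deletesEdge deletes present untouched a b ab =
  trans (deletesEdge-other deletes other) (present a b ab)
  where
  other : ¬ SamePair _ _ _ _
  other (inj₁ (au , bw)) = untouched (a , b , ab , au , bw)
  other (inj₂ (aw , bu)) = untouched (b , a , cycAdj-sym ab , bu , aw)

module _ {n t m} {G : Graph n} (C : Fin t → Fin (4 + m) → Fin n)
         (induced : ∀ i → InducedCycle G m (C i))
         (edge-disjoint : ∀ i j {u w} → HasEdge m (C i) u w → HasEdge m (C j) u w → i ≡ j) where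

  -- The cycles whose edges survive in the spanning subgraph H are still induced in H,
  -- and a deletion breaks at most one of them.
  private
    intact≤deletions : ∀ {H : Graph n} {k} → DeletionsToChordal H k → (∀ x y → Adj H x y → Adj G x y) →
      ∀ {j} (f : Fin j → Fin t) → Injective _≡_ _≡_ f → (∀ r → EdgesPresent H m (C (f r))) → j ≤ k
    intact≤deletions _ _ {zero} _ _ _ = z≤n
    intact≤deletions {H} (done chordal) H⊆G {suc j} f _ present =
      contradiction (inducedCycle-spanning {G = G} {H} H⊆G (induced (f zero)) (present zero))
                    (chordal m (C (f zero)))
    intact≤deletions {H} {suc k} (step {H = H′} (u , w , _ , deletes′) rest) H⊆G {suc j}
                     f f-injective present =
      removeBroken (any? λ r → hasEdge? m (C (f r)) u w)
      where
      deletes : DeletesEdge H H′ u w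
      deletes = deletesEdge deletes′

      H′⊆G : ∀ x y → Adj H′ x y → Adj G x y
      H′⊆G x y = H⊆G x y ∘ deletesEdge-⊆ deletes

      removeBroken : Dec (∃[ r ] HasEdge m (C (f r)) u w) → suc j ≤ suc k
      removeBroken (no untouched) = m≤n⇒m≤1+n (intact≤deletions rest H′⊆G f f-injective
        λ r → edgesPresent-deletesEdge deletes (present r) (untouched ∘ (r ,_)))
      removeBroken (yes (r₀ , hit)) = s≤s (intact≤deletions rest H′⊆G (f ∘ punchIn r₀)
        (punchIn-injective r₀ _ _ ∘ f-injective)
        λ r → edgesPresent-deletesEdge deletes (present (punchIn r₀ r))
                λ hit′ → punchInᵢ≢i r₀ r (f-injective (edge-disjoint _ _ hit′ hit)))

  deletions≥edgeDisjointInducedCycles : ∀ {k} → DeletionsToChordal G k → t ≤ k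
  deletions≥edgeDisjointInducedCycles deletions =
    intact≤deletions deletions (λ _ _ → id) id id (inducedCycle-edgesPresent {G = G} ∘ induced)

nonChordal⇒isChVS-1 : ∀ {n} {G : Graph n} → ¬ Chordal G → SplitsToChordal G 1 → IsChVS G 1
nonChordal⇒isChVS-1 ¬chordal split = split , λ where
  zero    (done chordal) → contradiction chordal ¬chordal
  (suc _) _              → s≤s z≤n

-- The separating family

n<ᵇn : ∀ n → (n <ᵇ n) ≡ false
n<ᵇn zero    = refl
n<ᵇn (suc n) = n<ᵇn n

n<ᵇ1+n : ∀ n → (n <ᵇ suc n) ≡ true
n<ᵇ1+n zero    = refl
n<ᵇ1+n (suc n) = n<ᵇ1+n n

<ᵇ-suc-≢ : ∀ {m n} → m ≢ n → (m <ᵇ n) ≡ (m <ᵇ suc n)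
<ᵇ-suc-≢ {zero}  {zero}  m≢n = contradiction refl m≢n
<ᵇ-suc-≢ {zero}  {suc n} _   = refl
<ᵇ-suc-≢ {suc m} {zero}  _   = refl
<ᵇ-suc-≢ {suc m} {suc n} m≢n = <ᵇ-suc-≢ (m≢n ∘ cong suc)

data V (t : ℕ) : Set where
  S X : V t
  P Q : Fin t → V t

module Family (t : ℕ) where

  N : ℕ
  N = 2 + (t + t)

  toV : Fin N → V t
  toV 0F            = S
  toV 1F            = X
  toV (suc (suc k)) = [ P , Q ]′ (splitAt t k)

  fromV : V t → Fin N
  fromV S     = 0F
  fromV X     = 1F
  fromV (P i) = suc (suc (i ↑ˡ t))
  fromV (Q i) = suc (suc (t ↑ʳ i))

  toV-fromV : ∀ v → toV (fromV v) ≡ v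
  toV-fromV S     = refl
  toV-fromV X     = refl
  toV-fromV (P i) = cong [ P , Q ]′ (splitAt-↑ˡ t i t)
  toV-fromV (Q i) = cong [ P , Q ]′ (splitAt-↑ʳ t t i)

  fromV-toV : ∀ x → fromV (toV x) ≡ x
  fromV-toV 0F            = refl
  fromV-toV 1F            = refl
  fromV-toV (suc (suc k)) =
    trans (fromV-PQ (splitAt t k)) (cong (λ z → suc (suc z)) (join-splitAt t t k))
    where
    fromV-PQ : ∀ s → fromV ([ P , Q ]′ s) ≡ suc (suc (join t t s))
    fromV-PQ (inj₁ _) = refl
    fromV-PQ (inj₂ _) = refl

  toV≡⇒ : ∀ {x v} → toV x ≡ v → x ≡ fromV v
  toV≡⇒ {x} refl = sym (fromV-toV x)

  toV-injective : ∀ {x y} → toV x ≡ toV y → x ≡ y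
  toV-injective eq = trans (toV≡⇒ eq) (fromV-toV _)

  samePair-fromV : ∀ {x y v w} → SamePair (toV x) (toV y) v w → SamePair x y (fromV v) (fromV w)
  samePair-fromV (inj₁ (xv , yw)) = inj₁ (toV≡⇒ xv , toV≡⇒ yw)
  samePair-fromV (inj₂ (xw , yv)) = inj₂ (toV≡⇒ xw , toV≡⇒ yv)

  adjV : (Fin t → Bool) → V t → V t → Bool
  adjV spoke S     (P i) = spoke i
  adjV spoke (P i) S     = spoke i
  adjV _     S     (Q _) = true
  adjV _     (Q _) S     = true
  adjV _     X     (P _) = true
  adjV _     (P _) X     = true
  adjV _     X     (Q _) = true
  adjV _     (Q _) X     = true
  adjV _     (P i) (P j) = not (does (i ≟ j))
  adjV _     (Q i) (Q j) = not (does (i ≟ j))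
  adjV _     _     _     = false

  private
    ≟-comm : ∀ (i j : Fin t) → does (i ≟ j) ≡ does (j ≟ i)
    ≟-comm i j with i ≟ j | j ≟ i
    ... | yes _    | yes _    = refl
    ... | no _     | no _     = refl
    ... | yes refl | no j≢i   = contradiction refl j≢i
    ... | no i≢j   | yes refl = contradiction refl i≢j

    distinct-adj : ∀ {i j : Fin t} → i ≢ j → not (does (i ≟ j)) ≡ true
    distinct-adj {i} {j} i≢j = cong not (dec-false (i ≟ j) i≢j)

  adjV-sym : ∀ D v w → adjV D v w ≡ adjV D w v
  adjV-sym D S     S     = refl
  adjV-sym D S     X     = refl
  adjV-sym D S     (P i) = refl
  adjV-sym D S     (Q i) = refl
  adjV-sym D X     S     = refl
  adjV-sym D X     X     = refl
  adjV-sym D X     (P i) = refl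
  adjV-sym D X     (Q i) = refl
  adjV-sym D (P i) S     = refl
  adjV-sym D (P i) X     = refl
  adjV-sym D (P i) (P j) = cong not (≟-comm i j)
  adjV-sym D (P i) (Q j) = refl
  adjV-sym D (Q i) S     = refl
  adjV-sym D (Q i) X     = refl
  adjV-sym D (Q i) (P j) = refl
  adjV-sym D (Q i) (Q j) = cong not (≟-comm i j)

  adjV-irrefl : ∀ D v → adjV D v v ≡ false
  adjV-irrefl D S     = refl
  adjV-irrefl D X     = refl
  adjV-irrefl D (P i) = cong not (dec-true (i ≟ i) refl)
  adjV-irrefl D (Q i) = cong not (dec-true (i ≟ i) refl)

  adjV-agree : ∀ {D D′} v w → (∀ {i} → SamePair v w S (P i) → D i ≡ D′ i) → adjV D v w ≡ adjV D′ v w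
  adjV-agree S     (P i) agree = agree (inj₁ (refl , refl))
  adjV-agree (P i) S     agree = agree (inj₂ (refl , refl))
  adjV-agree S     S     _ = refl
  adjV-agree S     X     _ = refl
  adjV-agree S     (Q _) _ = refl
  adjV-agree X     S     _ = refl
  adjV-agree X     X     _ = refl
  adjV-agree X     (P _) _ = refl
  adjV-agree X     (Q _) _ = refl
  adjV-agree (P _) X     _ = refl
  adjV-agree (P _) (P _) _ = refl
  adjV-agree (P _) (Q _) _ = refl
  adjV-agree (Q _) S     _ = refl
  adjV-agree (Q _) X     _ = refl
  adjV-agree (Q _) (P _) _ = refl
  adjV-agree (Q _) (Q _) _ = refl

  SpokeGraph : (Fin t → Bool) → Graph N
  SpokeGraph D = record
    { adj   = λ x y → adjV D (toV x) (toV y)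
    ; sym   = λ x y → adjV-sym D (toV x) (toV y)
    ; irref = λ x → adjV-irrefl D (toV x)
    }

  SpokeGraph-adj : ∀ D v w → adj (SpokeGraph D) (fromV v) (fromV w) ≡ adjV D v w
  SpokeGraph-adj D v w = cong₂ (adjV D) (toV-fromV v) (toV-fromV w)

  SpokeGraph-Adj : ∀ {D} v w → adjV D v w ≡ true → Adj (SpokeGraph D) (fromV v) (fromV w)
  SpokeGraph-Adj {D} v w = trans (SpokeGraph-adj D v w)

  SpokeGraph-¬Adj : ∀ {D} v w → adjV D v w ≡ false → ¬ Adj (SpokeGraph D) (fromV v) (fromV w)
  SpokeGraph-¬Adj {D} v w vw e = contradiction (trans (sym (trans (SpokeGraph-adj D v w) vw)) e) λ ()

  side : V t → Fin 2
  side S     = 0F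
  side (Q _) = 0F
  side X     = 1F
  side (P _) = 1F

  adjV-sameSide : ∀ D {v w} → v ≢ w → side v ≡ side w → adjV D v w ≡ true
  adjV-sameSide D {S}   {S}   v≢w _ = contradiction refl v≢w
  adjV-sameSide D {S}   {Q _} _   _ = refl
  adjV-sameSide D {Q _} {S}   _   _ = refl
  adjV-sameSide D {Q i} {Q j} v≢w _ = distinct-adj (v≢w ∘ cong Q)
  adjV-sameSide D {X}   {X}   v≢w _ = contradiction refl v≢w
  adjV-sameSide D {X}   {P _} _   _ = refl
  adjV-sameSide D {P _} {X}   _   _ = refl
  adjV-sameSide D {P i} {P j} v≢w _ = distinct-adj (v≢w ∘ cong P)

  SpokeGraph-α≤2 : ∀ D → αAtMost (SpokeGraph D) 2
  SpokeGraph-α≤2 D = cliqueCover⇒αAtMost (SpokeGraph D) (side ∘ toV) λ x y x≢y same →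
    adjV-sameSide D (x≢y ∘ toV-injective) same

  noSpokes : Fin t → Bool
  noSpokes _ = false

  noSpokes-cluster : ∀ {v w} → v ≢ X → w ≢ X → v ≢ w → adjV noSpokes v w ≡ true ⇔ side v ≡ side w
  noSpokes-cluster v≢X w≢X v≢w = mk⇔ (sameSide v≢X w≢X) (adjV-sameSide noSpokes v≢w)
    where
    sameSide : ∀ {v w} → v ≢ X → w ≢ X → adjV noSpokes v w ≡ true → side v ≡ side w
    sameSide {X}   v≢X _     _ = contradiction refl v≢X
    sameSide {_}   {X} _ w≢X _ = contradiction refl w≢X
    sameSide {S}   {Q _} _ _ _ = refl
    sameSide {Q _} {S}   _ _ _ = refl
    sameSide {P _} {P _} _ _ _ = refl
    sameSide {Q _} {Q _} _ _ _ = refl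

  noSpokes-chordal : Chordal (SpokeGraph noSpokes)
  noSpokes-chordal = clusterMinusVertex⇒chordal (SpokeGraph noSpokes) (fromV X) (side ∘ toV)
    λ x y x≢X y≢X x≢y → noSpokes-cluster (x≢X ∘ toV≡⇒) (y≢X ∘ toV≡⇒) (x≢y ∘ toV-injective)

  deleteSpoke : ∀ {D D′} j → D j ≡ false → D′ j ≡ true → (∀ i → i ≢ j → D i ≡ D′ i) →
    DeleteEdge (SpokeGraph D′) (SpokeGraph D)
  deleteSpoke {D} {D′} j Dj D′j others =
    fromV S , fromV (P j) , SpokeGraph-Adj S (P j) D′j , DeletesEdge.deleted-adj deletes
    where
    unchanged : ∀ x y → ¬ SamePair x y (fromV S) (fromV (P j)) →
      adj (SpokeGraph D) x y ≡ adj (SpokeGraph D′) x y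
    unchanged x y other =
      adjV-agree (toV x) (toV y) λ same → others _ λ { refl → other (samePair-fromV same) }

    deletes : DeletesEdge (SpokeGraph D′) (SpokeGraph D) (fromV S) (fromV (P j))
    deletes = deletesEdge-intro (SpokeGraph-¬Adj S (P j) Dj) unchanged

  spokes : ℕ → Fin t → Bool
  spokes r i = toℕ i <ᵇ r

  spokes-deletions : ∀ r → r ≤ t → DeletionsToChordal (SpokeGraph (spokes r)) r
  spokes-deletions zero    _   = done noSpokes-chordal
  spokes-deletions (suc r) r<t = step (deleteSpoke j absent present others) (spokes-deletions r (<⇒≤ r<t))
    where
    j : Fin t
    j = fromℕ< r<t

    toℕ-j : toℕ j ≡ r
    toℕ-j = toℕ-fromℕ< r<t

    absent : spokes r j ≡ false
    absent rewrite toℕ-j = n<ᵇn r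

    present : spokes (suc r) j ≡ true
    present rewrite toℕ-j = n<ᵇ1+n r

    others : ∀ i → i ≢ j → spokes r i ≡ spokes (suc r) i
    others i i≢j = <ᵇ-suc-≢ λ eq → i≢j (toℕ-injective (trans eq (sym toℕ-j)))

  AllSpokes : Graph N
  AllSpokes = SpokeGraph (spokes t)

  spokes-all : ∀ i → spokes t i ≡ true
  spokes-all i = Equivalence.to T-≡ (<⇒<ᵇ (toℕ<n i))

  cycleV : Fin t → Fin 4 → V t
  cycleV i 0F = S
  cycleV i 1F = P i
  cycleV i 2F = X
  cycleV i 3F = Q i

  C : Fin t → Fin 4 → Fin N
  C i = fromV ∘ cycleV i

  C-induced : ∀ i → InducedCycle AllSpokes 0 (C i)
  C-induced i = inducedC₄ {G = AllSpokes} (C i)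
    (SpokeGraph-Adj S (P i) (spokes-all i)) (SpokeGraph-Adj (P i) X refl)
    (SpokeGraph-Adj X (Q i) refl) (SpokeGraph-Adj (Q i) S refl)
    (SpokeGraph-¬Adj {spokes t} S X refl) (SpokeGraph-¬Adj (P i) (Q i) refl) (λ ()) P≢Q
    where
    P≢Q : fromV (P i) ≢ fromV (Q i)
    P≢Q eq with () ← trans (sym (toV-fromV (P i))) (trans (cong toV eq) (toV-fromV (Q i)))

  -- Every edge of the i-th cycle has P i or Q i as an end, so it determines i.
  index : V t → V t → Maybe (Fin t)
  index (P i) _     = just i
  index (Q i) _     = just i
  index _     (P i) = just i
  index _     (Q i) = just i
  index _     _     = nothing

  index-cycleV : ∀ i {a b} → CycAdj 0 a b → index (cycleV i a) (cycleV i b) ≡ just i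
  index-cycleV i {1F}      _  = refl
  index-cycleV i {3F}      _  = refl
  index-cycleV i {0F} {1F} _  = refl
  index-cycleV i {0F} {3F} _  = refl
  index-cycleV i {2F} {1F} _  = refl
  index-cycleV i {2F} {3F} _  = refl
  index-cycleV i {0F} {0F} ab = contradiction ab (¬cycAdj {0})
  index-cycleV i {0F} {2F} ab = contradiction ab (¬cycAdj {0})
  index-cycleV i {2F} {0F} ab = contradiction ab (¬cycAdj {0})
  index-cycleV i {2F} {2F} ab = contradiction ab (¬cycAdj {0})

  C-edge-disjoint : ∀ i j {u w} → HasEdge 0 (C i) u w → HasEdge 0 (C j) u w → i ≡ j
  C-edge-disjoint i j ei ej = just-injective (trans (sym (index-edge i ei)) (index-edge j ej))
    where
    index-edge : ∀ i {u w} → HasEdge 0 (C i) u w → index (toV u) (toV w) ≡ just i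
    index-edge i (a , b , ab , refl , refl) =
      trans (cong₂ index (toV-fromV _) (toV-fromV _)) (index-cycleV i ab)

  AllSpokes-not-chordal : Fin t → ¬ Chordal AllSpokes
  AllSpokes-not-chordal i chordal = chordal 0 (C i) (C-induced i)

  AllSpokes-ched : IsChED AllSpokes t
  AllSpokes-ched =
    spokes-deletions t ≤-refl , λ _ → deletions≥edgeDisjointInducedCycles C C-induced C-edge-disjoint

  isP isQ : V t → Bool
  isP (P _) = true
  isP _     = false
  isQ (Q _) = true
  isQ _     = false

  private
    Q⊆N : ∀ y → isQ (toV y) ≡ true → Adj AllSpokes (fromV S) y
    Q⊆N y = Q-neighbour (toV y)
      where
      Q-neighbour : ∀ v → isQ v ≡ true → adjV (spokes t) S v ≡ true
      Q-neighbour (Q _) _ = refl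

    P⊆N : ∀ y → isP (toV y) ≡ true → Adj AllSpokes (fromV S) y
    P⊆N y = P-neighbour (toV y)
      where
      P-neighbour : ∀ v → isP v ≡ true → adjV (spokes t) S v ≡ true
      P-neighbour (P i) _ = spokes-all i

    covers : ∀ y → Adj AllSpokes (fromV S) y → isQ (toV y) ∨ isP (toV y) ≡ true
    covers y = neighbour (toV y)
      where
      neighbour : ∀ v → adjV (spokes t) S v ≡ true → isQ v ∨ isP v ≡ true
      neighbour (P _) _ = refl
      neighbour (Q _) _ = refl

  SplitS : Graph (suc N)
  SplitS = splitGraph AllSpokes (fromV S) (isQ ∘ toV) (isP ∘ toV) Q⊆N

  -- 0F is the new copy of S, adjacent to the P i; 1F = suc (fromV S) is the copy adjacent to the Q i.
  SplitS-side : Fin (suc N) → Fin 2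
  SplitS-side 0F      = 1F
  SplitS-side (suc x) = side (toV x)

  private
    Cluster : Fin (suc N) → Fin (suc N) → Set
    Cluster p q = Adj SplitS p q ⇔ SplitS-side p ≡ SplitS-side q

    Cluster-sym : ∀ p q → Cluster p q → Cluster q p
    Cluster-sym p q c =
      mk⇔ (λ qp → sym (to c (Adj-sym SplitS {q} {p} qp))) (λ eq → Adj-sym SplitS {p} {q} (from c (sym eq)))
      where open Equivalence

    not-X : ∀ {x} → suc x ≢ suc (fromV X) → toV x ≢ X
    not-X x≢X = x≢X ∘ cong suc ∘ toV≡⇒

    not-S : ∀ {x} → toV (suc x) ≢ S
    not-S {x} eq with () ← toV≡⇒ {suc x} eq

    cluster-new : ∀ y → suc y ≢ suc (fromV X) → Cluster 0F (suc y)
    cluster-new y y≢X = P⇔ (not-X y≢X)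
      where
      P⇔ : ∀ {v} → v ≢ X → isP v ≡ true ⇔ 1F ≡ side v
      P⇔ {S}   _   = mk⇔ (λ ()) (λ ())
      P⇔ {X}   v≢X = contradiction refl v≢X
      P⇔ {P _} _   = mk⇔ (λ _ → refl) (λ _ → refl)
      P⇔ {Q _} _   = mk⇔ (λ ()) (λ ())

    cluster-S : ∀ y → suc (suc y) ≢ suc (fromV X) → Cluster 1F (suc (suc y))
    cluster-S y y≢X = Q⇔ (not-X y≢X) (not-S {y})
      where
      Q⇔ : ∀ {v} → v ≢ X → v ≢ S → isQ v ≡ true ⇔ 0F ≡ side v
      Q⇔ {S}   _   v≢S = contradiction refl v≢S
      Q⇔ {X}   v≢X _   = contradiction refl v≢X
      Q⇔ {P _} _   _   = mk⇔ (λ ()) (λ ())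
      Q⇔ {Q _} _   _   = mk⇔ (λ _ → refl) (λ _ → refl)

    cluster-old : ∀ x y → suc (suc x) ≢ suc (fromV X) → suc (suc y) ≢ suc (fromV X) → x ≢ y →
      Cluster (suc (suc x)) (suc (suc y))
    cluster-old x y x≢X y≢X x≢y = mk⇔ (to cluster ∘ trans (sym spokeFree)) (trans spokeFree ∘ from cluster)
      where
      open Equivalence
      spokeFree : adjV (spokes t) (toV (suc x)) (toV (suc y)) ≡ adjV noSpokes (toV (suc x)) (toV (suc y))
      spokeFree = adjV-agree (toV (suc x)) (toV (suc y)) λ where
        (inj₁ (x≡S , _)) → contradiction x≡S (not-S {x})
        (inj₂ (_ , y≡S)) → contradiction y≡S (not-S {y})

      cluster : adjV noSpokes (toV (suc x)) (toV (suc y)) ≡ true ⇔ side (toV (suc x)) ≡ side (toV (suc y))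
      cluster = noSpokes-cluster (not-X x≢X) (not-X y≢X) (x≢y ∘ suc-injective ∘ toV-injective)

  SplitS-cluster : ∀ p q → p ≢ suc (fromV X) → q ≢ suc (fromV X) → p ≢ q →
    Adj SplitS p q ⇔ SplitS-side p ≡ SplitS-side q
  SplitS-cluster 0F            0F            _   _   p≢q = contradiction refl p≢q
  SplitS-cluster 0F            (suc y)       _   y≢X _   = cluster-new y y≢X
  SplitS-cluster (suc x)       0F            x≢X _   _   = Cluster-sym 0F (suc x) (cluster-new x x≢X)
  SplitS-cluster 1F            1F            _   _   p≢q = contradiction refl p≢q
  SplitS-cluster 1F            (suc (suc y)) _   y≢X _   = cluster-S y y≢X
  SplitS-cluster (suc (suc x)) 1F            x≢X _   _   = Cluster-sym 1F (suc (suc x)) (cluster-S x x≢X)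
  SplitS-cluster (suc (suc x)) (suc (suc y)) x≢X y≢X p≢q =
    cluster-old x y x≢X y≢X (p≢q ∘ cong (λ z → suc (suc z)))

  AllSpokes-one-split : SplitsToChordal AllSpokes 1
  AllSpokes-one-split = step {H = SplitS} (splitGraph-split Q⊆N P⊆N covers)
    (done (clusterMinusVertex⇒chordal SplitS (suc (fromV X)) SplitS-side SplitS-cluster))

separatingFamily : ∀ t → ∃[ n ] ∃[ G ] αAtMost {n} G 2 × IsChVS G 1 × IsChED G (suc t)
separatingFamily t = _ , AllSpokes , SpokeGraph-α≤2 (spokes (suc t)) ,
  nonChordal⇒isChVS-1 (AllSpokes-not-chordal zero) AllSpokes-one-split , AllSpokes-ched
  where open Family (suc t)

theorem3 :
    (∀ {n} (G : Graph n) (a b : ℕ) → IsChVS G a → IsChED G b → a ≤ b) ×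
    ¬ (Σ (ℕ → ℕ) λ f →
         ∀ {n} (G : Graph n) → αAtMost G 2 →
           ∀ (a b : ℕ) → IsChVS G a → IsChED G b → b ≤ f a)
theorem3 = chvs≤ched , λ (f , bounded) →
  let _ , G , α≤2 , chvs , ched = separatingFamily (f 1)
  in 1+n≰n (bounded G α≤2 1 (suc (f 1)) chvs ched)
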